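{- Let $p$ be a prime and $V$ a $2m$-dimensional vector space over $\mathrm{GF}(p)$. Let $H\leqslant\mathrm{GL}_{2m}(p)=\mathrm{GL}(V)$ stabilise the pair $\{V_1,V_2\}$ of subspaces of $V$, where $V=V_1\oplus V_2$ and $\dim(V_1)=\dim(V_2)=m$. Suppose that $(V_1\cup V_2)\setminus\{0\}$ is an orbit of $H$ on the nonzero vectors of $V$. Then every orbit of $H$ on $V\setminus\{0\}$ has length divisible by $|V_1|-1$. -}

module Defs where

open import Data.Nat using (ℕ; zero; suc; NonZero; _+_)
open import Data.Nat.DivMod using (_mod_)
open import Data.Fin using (Fin; toℕ)
open import Data.Fin.Properties using () renaming (_≟_ to _≟F_)
open import Data.Vec using (Vec; []; _∷_; map; replicate; foldr; zipWith; _++_; tabulate; lookup)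
open import Data.Vec.Properties using (≡-dec)
open import Data.List using (List; length; deduplicate)
import Data.List as L
open import Data.Product using (Σ; ∃; ∃-syntax; _×_; _,_)
open import Data.Sum using (_⊎_)
open import Relation.Nullary using (¬_; ⌊_⌋)
open import Data.Bool using (if_then_else_)
open import Data.List.Membership.Propositional using (_∈_)
open import Data.List.Relation.Unary.Unique.Propositional using (Unique)
open import Relation.Binary.PropositionalEquality using (_≡_)
open import Relation.Binary.Definitions using (DecidableEquality)

module GF (p : ℕ) .{{_ : NonZero p}} where

  F : Set
  F = Fin p

  0F : F
  0F = 0 mod p

  1F : F
  1F = 1 mod p

  _+F_ : F → F → F
  a +F b = (toℕ a + toℕ b) mod p

  _*F_ : F → F → F
  a *F b = (toℕ a Data.Nat.* toℕ b) mod p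

  Vect : ℕ → Set
  Vect n = Vec F n

  _≟V_ : ∀ {n} → DecidableEquality (Vect n)
  _≟V_ = ≡-dec _≟F_

  zeroV : ∀ {n} → Vect n
  zeroV = replicate _ 0F

  dot : ∀ {n} → Vect n → Vect n → F
  dot u v = foldr _ _+F_ 0F (zipWith _*F_ u v)

  -- n×n matrices over F, as lists of rows
  Mat : ℕ → Set
  Mat n = Vec (Vect n) n

  _·_ : ∀ {n} → Mat n → Vect n → Vect n
  M · v = map (λ row → dot row v) M

  column : ∀ {n} → Mat n → Fin n → Vect n
  column M j = map (λ row → lookup row j) M

  _⊗_ : ∀ {n} → Mat n → Mat n → Mat n
  M ⊗ N = map (λ row → tabulate (λ j → dot row (column N j))) M

  idM : ∀ {n} → Mat n
  idM = tabulate (λ i → tabulate (λ j → if ⌊ i ≟F j ⌋ then 1F else 0F))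

  Invertible : ∀ {n} → Mat n → Set
  Invertible M = ∃[ N ] (M ⊗ N ≡ idM × N ⊗ M ≡ idM)

  record IsSubgroupGL {n : ℕ} (H : List (Mat n)) : Set where
    field
      unique   : Unique H
      invertible : ∀ {h} → h ∈ H → Invertible h
      hasId    : idM ∈ H
      closed⊗  : ∀ {g h} → g ∈ H → h ∈ H → (g ⊗ h) ∈ H
      closedInv : ∀ {h} → h ∈ H → ∃[ g ] (g ∈ H × g ⊗ h ≡ idM × h ⊗ g ≡ idM)

  -- The decomposition V = V₁ ⊕ V₂ with dim V₁ = dim V₂ = m, where V = GF(p)^(m+m):
  -- given by an invertible matrix B (a basis adapted to the decomposition),
  -- V₁ = span of the first m columns of B, V₂ = span of the last m columns.
  InV₁ : ∀ m → Mat (m + m) → Vect (m + m) → Set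
  InV₁ m B v = ∃[ a ] (v ≡ B · (a ++ zeroV {m}))

  InV₂ : ∀ m → Mat (m + m) → Vect (m + m) → Set
  InV₂ m B v = ∃[ b ] (v ≡ B · (zeroV {m} ++ b))

  MapsOnto : ∀ {n} → Mat n → (Vect n → Set) → (Vect n → Set) → Set
  MapsOnto h P Q = (∀ v → P v → Q (h · v)) × (∀ w → Q w → ∃[ v ] (P v × h · v ≡ w))

  StabilisesPair : ∀ {n} → List (Mat n) → (Vect n → Set) → (Vect n → Set) → Set
  StabilisesPair H P Q = ∀ {h} → h ∈ H →
    (MapsOnto h P P × MapsOnto h Q Q) ⊎ (MapsOnto h P Q × MapsOnto h Q P)

  IsOrbitOf : ∀ {n} → List (Mat n) → Vect n → (Vect n → Set) → Set
  IsOrbitOf H v S = ∀ w → (S w → ∃[ h ] (h ∈ H × h · v ≡ w)) × (∀ {h} → h ∈ H → S (h · v))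

  orbit : ∀ {n} → List (Mat n) → Vect n → List (Vect n)
  orbit H v = deduplicate _≟V_ (L.map (λ h → h · v) H)

  orbitLength : ∀ {n} → List (Mat n) → Vect n → ℕ
  orbitLength H v = length (orbit H v)

module Submission where

-- In the coordinates (π₁, π₂) of V = V₁ ⊕ V₂ given by B, let P = GF(p)^m ∖ 0, so |P| = p^m - 1.
-- An orbit meeting V₁ ∪ V₂ is the whole of (V₁ ∪ V₂) ∖ 0, which has 2|P| elements. Any other orbit O
-- avoids V₁ ∪ V₂ (H permutes {V₁, V₂}), so π₁ maps O into P. For y, y' ∈ P, transitivity on
-- (V₁ ∪ V₂) ∖ 0 yields k ∈ H with k(y, 0) = (y', 0); such a k cannot swap V₁ and V₂, so it fixes V₂
-- and maps the π₁-fibre of O over y injectively into the fibre over y'. Hence all fibres have the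
-- same size and |P| divides |O|.

open import Defs
open import Algebra.Structures using (IsCommutativeMonoid)
import Algebra.Properties.CommutativeSemigroup as CommutativeSemigroupProperties
open import Data.Bool using (if_then_else_)
open import Data.Empty using (⊥-elim)
open import Data.Fin using (Fin; toℕ)
import Data.Fin as Fin
open import Data.Fin.Properties using (toℕ-fromℕ<; fromℕ<-cong; toℕ-injective; toℕ<n)
  renaming (_≟_ to _≟F_)
open import Data.List using (List; []; _∷_; length; filter; cartesianProductWith; allFin)
import Data.List as L
open import Data.List.Properties using (filter-notAll; filter-accept; filter-reject; length-map; length-++; length-tabulate)
open import Data.List.Membership.Propositional using (_∈_)
open import Data.List.Membership.Propositional.Properties
  using (∈-++⁺ˡ; ∈-++⁺ʳ; ∈-++⁻; ∈-deduplicate⁺; ∈-deduplicate⁻; ∈-filter⁺; ∈-filter⁻; ∈-map⁺; ∈-map⁻; ∈-allFin; ∈-cartesianProductWith⁺)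
open import Data.List.Relation.Binary.Disjoint.Propositional using (Disjoint)
open import Data.List.Relation.Binary.Subset.Propositional using (_⊆_)
open import Data.List.Relation.Unary.All as All using (All; []; _∷_)
open import Data.List.Relation.Unary.AllPairs using ([]; _∷_)
import Data.List.Relation.Unary.Any as Any
open import Data.List.Relation.Unary.Any using (here; there)
open import Data.List.Relation.Unary.Unique.Propositional using (Unique)
open import Data.List.Relation.Unary.Unique.DecPropositional.Properties using (deduplicate-!)
open import Data.List.Relation.Unary.Unique.Propositional.Properties
  using (map⁺; ++⁺; filter⁺; allFin⁺; cartesianProductWith⁺)
open import Data.Nat using (ℕ; zero; suc; NonZero; _+_; _*_; _^_; _∸_; _≤_; _%_; z≤n)
open import Data.Nat.DivMod using (_mod_; m%n<n; %-distribˡ-+; %-distribˡ-*; m<n⇒m%n≡m)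
open import Data.Nat.Divisibility using (_∣_; m∣m*n; ∣-refl; ∣m∣n⇒∣m+n)
open import Data.Nat.ListAction using (sum)
open import Data.Nat.Primality using (Prime)
open import Data.Nat.Properties
  using (+-comm; +-assoc; *-comm; *-assoc; *-distribˡ-+; *-identityˡ; *-zeroʳ; +-suc; ≤-antisym; module ≤-Reasoning)
open import Data.Product using (∃-syntax; _×_; _,_; proj₁; proj₂)
open import Data.Sum using (_⊎_; inj₁; inj₂)
open import Data.Vec using (Vec; []; _∷_; map; zipWith; _++_; tabulate; lookup; take; drop)
open import Data.Vec.Properties
  using (∷-injective; ++-injectiveˡ; ++-injectiveʳ; take++drop≡id; zipWith-++; zipWith-identityˡ; zipWith-identityʳ;
         tabulate-cong; tabulate-∘; tabulate∘lookup)
open import Function using (_∘_)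
open import Relation.Binary.Definitions using (DecidableEquality)
open import Relation.Binary.PropositionalEquality
open import Relation.Binary.PropositionalEquality.Algebra using (isMagma)
open import Relation.Nullary using (¬_; ⌊_⌋; ¬?; Dec; yes; no)

module Counting where

  module _ {a} {A : Set a} where

    sum-map-const : ∀ (h : A → ℕ) {c} xs → (∀ {x} → x ∈ xs → h x ≡ c) → sum (L.map h xs) ≡ length xs * c
    sum-map-const h []       _   = refl
    sum-map-const h (x ∷ xs) h≡c = cong₂ _+_ (h≡c (here refl)) (sum-map-const h xs (h≡c ∘ there))

  module _ {a} {A : Set a} (_≟_ : DecidableEquality A) where

    length-mono-⊆ : ∀ {xs ys : List A} → Unique xs → xs ⊆ ys → length xs ≤ length ys
    length-mono-⊆ {[]}     _            _     = z≤n
    length-mono-⊆ {x ∷ xs} {ys} (x∉xs ∷ xs!) xs⊆ys = begin-strict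
      length xs               ≤⟨ length-mono-⊆ xs! xs⊆ys∖x ⟩
      length (filter ≢x? ys)  <⟨ filter-notAll ≢x? ys (Any.map (λ x≡y y≢x → y≢x (sym x≡y)) (xs⊆ys (here refl))) ⟩
      length ys               ∎
      where
      open ≤-Reasoning
      ≢x? = λ y → ¬? (y ≟ x)
      xs⊆ys∖x : xs ⊆ filter ≢x? ys
      xs⊆ys∖x z∈xs = ∈-filter⁺ ≢x? (xs⊆ys (there z∈xs)) (λ z≡x → All.lookup x∉xs z∈xs (sym z≡x))

    length-≡-⊆⊇ : ∀ {xs ys : List A} → Unique xs → Unique ys → xs ⊆ ys → ys ⊆ xs → length xs ≡ length ys
    length-≡-⊆⊇ xs! ys! xs⊆ys ys⊆xs = ≤-antisym (length-mono-⊆ xs! xs⊆ys) (length-mono-⊆ ys! ys⊆xs)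

  module Fibres {a b} {X : Set a} {Y : Set b} (_≟_ : DecidableEquality Y) (f : X → Y) where

    fibre : Y → List X → List X
    fibre y = filter (λ x → f x ≟ y)

    fibreSizes : List X → List Y → ℕ
    fibreSizes O P = sum (L.map (λ y → length (fibre y O)) P)

    fibreSizes-∷-∉ : ∀ {x} O {P} → All (f x ≢_) P → fibreSizes (x ∷ O) P ≡ fibreSizes O P
    fibreSizes-∷-∉ O []             = refl
    fibreSizes-∷-∉ O (fx≢y ∷ fx∉P) =
      cong₂ _+_ (cong length (filter-reject (λ x → f x ≟ _) fx≢y)) (fibreSizes-∷-∉ O fx∉P)

    fibreSizes-∷-∈ : ∀ {x} O {P} → Unique P → f x ∈ P → fibreSizes (x ∷ O) P ≡ suc (fibreSizes O P)
    fibreSizes-∷-∈ O (y∉P ∷ _) (here refl) =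
      cong₂ _+_ (cong length (filter-accept (λ x → f x ≟ _) refl)) (fibreSizes-∷-∉ O y∉P)
    fibreSizes-∷-∈ O (y∉P ∷ P!) (there fx∈P) = trans
      (cong₂ _+_ (cong length (filter-reject (λ x → f x ≟ _) λ fx≡y → All.lookup y∉P fx∈P (sym fx≡y)))
                 (fibreSizes-∷-∈ O P! fx∈P))
      (+-suc _ _)

    length≡fibreSizes : ∀ {P} → Unique P → ∀ O → (∀ {x} → x ∈ O → f x ∈ P) → length O ≡ fibreSizes O P
    length≡fibreSizes {P} P! []      _      = sym (trans (sum-map-const _ P (λ _ → refl)) (*-zeroʳ (length P)))
    length≡fibreSizes     P! (x ∷ O) f[O]⊆P = trans (cong suc (length≡fibreSizes P! O (f[O]⊆P ∘ there)))
      (sym (fibreSizes-∷-∈ O P! (f[O]⊆P (here refl))))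

    equal-fibres⇒∣ : ∀ {P c} → Unique P → ∀ O → (∀ {x} → x ∈ O → f x ∈ P) →
      (∀ {y} → y ∈ P → length (fibre y O) ≡ c) → length P ∣ length O
    equal-fibres⇒∣ {P} {c} P! O f[O]⊆P fibre≡c = subst (length P ∣_)
      (sym (trans (length≡fibreSizes P! O f[O]⊆P) (sum-map-const _ P fibre≡c)))
      (m∣m*n c)

  module Enumeration {a} {A : Set a} (xs : List A) where

    vectors : ∀ n → List (Vec A n)
    vectors zero    = [] ∷ []
    vectors (suc n) = cartesianProductWith _∷_ xs (vectors n)

    ∈-vectors : (∀ x → x ∈ xs) → ∀ {n} (v : Vec A n) → v ∈ vectors n
    ∈-vectors _     []      = here refl
    ∈-vectors xs-all (x ∷ v) = ∈-cartesianProductWith⁺ _∷_ (xs-all x) (∈-vectors xs-all v)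

    vectors⁺ : Unique xs → ∀ n → Unique (vectors n)
    vectors⁺ _   zero    = [] ∷ []
    vectors⁺ xs! (suc n) = cartesianProductWith⁺ _∷_ ∷-injective xs! (vectors⁺ xs! n)

    length-vectors : ∀ n → length (vectors n) ≡ length xs ^ n
    length-vectors zero    = refl
    length-vectors (suc n) = trans (length-cartesianProductWith xs) (cong (length xs *_) (length-vectors n))
      where
      length-cartesianProductWith : ∀ ys → length (cartesianProductWith _∷_ ys (vectors n)) ≡ length ys * length (vectors n)
      length-cartesianProductWith []       = refl
      length-cartesianProductWith (y ∷ ys) = trans (length-++ (L.map (y ∷_) (vectors n)))
        (cong₂ _+_ (length-map (y ∷_) (vectors n)) (length-cartesianProductWith ys))

module GFProperties (p : ℕ) .{{_ : NonZero p}} where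
  open GF p

  toℕ-mod : ∀ x → toℕ (x mod p) ≡ x % p
  toℕ-mod x = toℕ-fromℕ< (m%n<n x p)

  mod-toℕ : ∀ (a : F) → toℕ a mod p ≡ a
  mod-toℕ a = toℕ-injective (trans (toℕ-mod (toℕ a)) (m<n⇒m%n≡m (toℕ<n a)))

  mod-distrib-+ : ∀ x y → (x + y) mod p ≡ (x mod p) +F (y mod p)
  mod-distrib-+ x y = fromℕ<-cong _ _
    (trans (%-distribˡ-+ x y p) (sym (cong₂ (λ a b → (a + b) % p) (toℕ-mod x) (toℕ-mod y)))) _ _

  mod-distrib-* : ∀ x y → (x * y) mod p ≡ (x mod p) *F (y mod p)
  mod-distrib-* x y = fromℕ<-cong _ _
    (trans (%-distribˡ-* x y p) (sym (cong₂ (λ a b → (a * b) % p) (toℕ-mod x) (toℕ-mod y)))) _ _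

  +F-comm : ∀ a b → a +F b ≡ b +F a
  +F-comm a b = cong (_mod p) (+-comm (toℕ a) (toℕ b))

  *F-comm : ∀ a b → a *F b ≡ b *F a
  *F-comm a b = cong (_mod p) (*-comm (toℕ a) (toℕ b))

  +F-assoc : ∀ a b c → (a +F b) +F c ≡ a +F (b +F c)
  +F-assoc a b c = begin
    (a +F b) +F c                         ≡⟨ cong ((a +F b) +F_) (mod-toℕ c) ⟨
    (a +F b) +F (toℕ c mod p)             ≡⟨ mod-distrib-+ (toℕ a + toℕ b) (toℕ c) ⟨
    (toℕ a + toℕ b + toℕ c) mod p         ≡⟨ cong (_mod p) (+-assoc (toℕ a) (toℕ b) (toℕ c)) ⟩
    (toℕ a + (toℕ b + toℕ c)) mod p       ≡⟨ mod-distrib-+ (toℕ a) (toℕ b + toℕ c) ⟩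
    (toℕ a mod p) +F (b +F c)             ≡⟨ cong (_+F (b +F c)) (mod-toℕ a) ⟩
    a +F (b +F c)                         ∎
    where open ≡-Reasoning

  *F-assoc : ∀ a b c → (a *F b) *F c ≡ a *F (b *F c)
  *F-assoc a b c = begin
    (a *F b) *F c                         ≡⟨ cong ((a *F b) *F_) (mod-toℕ c) ⟨
    (a *F b) *F (toℕ c mod p)             ≡⟨ mod-distrib-* (toℕ a * toℕ b) (toℕ c) ⟨
    (toℕ a * toℕ b * toℕ c) mod p         ≡⟨ cong (_mod p) (*-assoc (toℕ a) (toℕ b) (toℕ c)) ⟩
    (toℕ a * (toℕ b * toℕ c)) mod p       ≡⟨ mod-distrib-* (toℕ a) (toℕ b * toℕ c) ⟩
    (toℕ a mod p) *F (b *F c)             ≡⟨ cong (_*F (b *F c)) (mod-toℕ a) ⟩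
    a *F (b *F c)                         ∎
    where open ≡-Reasoning

  *F-distribˡ-+F : ∀ a b c → a *F (b +F c) ≡ (a *F b) +F (a *F c)
  *F-distribˡ-+F a b c = begin
    a *F (b +F c)                           ≡⟨ cong (_*F (b +F c)) (mod-toℕ a) ⟨
    (toℕ a mod p) *F (b +F c)               ≡⟨ mod-distrib-* (toℕ a) (toℕ b + toℕ c) ⟨
    (toℕ a * (toℕ b + toℕ c)) mod p         ≡⟨ cong (_mod p) (*-distribˡ-+ (toℕ a) (toℕ b) (toℕ c)) ⟩
    (toℕ a * toℕ b + toℕ a * toℕ c) mod p   ≡⟨ mod-distrib-+ (toℕ a * toℕ b) (toℕ a * toℕ c) ⟩
    (a *F b) +F (a *F c)                    ∎
    where open ≡-Reasoning

  *F-distribʳ-+F : ∀ a b c → (b +F c) *F a ≡ (b *F a) +F (c *F a)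
  *F-distribʳ-+F a b c =
    trans (*F-comm _ a) (trans (*F-distribˡ-+F a b c) (cong₂ _+F_ (*F-comm a b) (*F-comm a c)))

  +F-identityˡ : ∀ a → 0F +F a ≡ a
  +F-identityˡ a =
    trans (cong (0F +F_) (sym (mod-toℕ a))) (trans (sym (mod-distrib-+ 0 (toℕ a))) (mod-toℕ a))

  +F-identityʳ : ∀ a → a +F 0F ≡ a
  +F-identityʳ a = trans (+F-comm a 0F) (+F-identityˡ a)

  *F-identityˡ : ∀ a → 1F *F a ≡ a
  *F-identityˡ a = trans (cong (1F *F_) (sym (mod-toℕ a)))
    (trans (sym (mod-distrib-* 1 (toℕ a))) (trans (cong (_mod p) (*-identityˡ (toℕ a))) (mod-toℕ a)))

  *F-zeroˡ : ∀ a → 0F *F a ≡ 0F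
  *F-zeroˡ a = trans (cong (0F *F_) (sym (mod-toℕ a))) (sym (mod-distrib-* 0 (toℕ a)))

  *F-zeroʳ : ∀ a → a *F 0F ≡ 0F
  *F-zeroʳ a = trans (*F-comm a 0F) (*F-zeroˡ a)

  +F-isCommutativeMonoid : IsCommutativeMonoid _≡_ _+F_ 0F
  +F-isCommutativeMonoid = record
    { isMonoid = record
      { isSemigroup = record { isMagma = isMagma _+F_ ; assoc = +F-assoc }
      ; identity    = +F-identityˡ , +F-identityʳ
      }
    ; comm = +F-comm
    }

  +F-interchange : ∀ a b c d → (a +F b) +F (c +F d) ≡ (a +F c) +F (b +F d)
  +F-interchange = CommutativeSemigroupProperties.interchange
    (record { isCommutativeSemigroup = IsCommutativeMonoid.isCommutativeSemigroup +F-isCommutativeMonoid })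

  infixl 6 _+V_
  _+V_ : ∀ {n} → Vect n → Vect n → Vect n
  _+V_ = zipWith _+F_

  infixr 7 _•_
  _•_ : ∀ {n} → F → Vect n → Vect n
  c • v = map (c *F_) v

  unitRow : ∀ {n} → Fin n → Vect n
  unitRow i = tabulate (λ j → if ⌊ i ≟F j ⌋ then 1F else 0F)

  dot-zeroˡ : ∀ {n} (v : Vect n) → dot (tabulate (λ _ → 0F)) v ≡ 0F
  dot-zeroˡ []      = refl
  dot-zeroˡ (a ∷ v) = trans (cong₂ _+F_ (*F-zeroˡ a) (dot-zeroˡ v)) (+F-identityˡ 0F)

  dot-zeroʳ : ∀ {n} (u : Vect n) → dot u zeroV ≡ 0F
  dot-zeroʳ []      = refl
  dot-zeroʳ (a ∷ u) = trans (cong₂ _+F_ (*F-zeroʳ a) (dot-zeroʳ u)) (+F-identityˡ 0F)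

  dot-distribʳ-+V : ∀ {n} (u v w : Vect n) → dot u (v +V w) ≡ dot u v +F dot u w
  dot-distribʳ-+V []      []      []      = sym (+F-identityˡ 0F)
  dot-distribʳ-+V (a ∷ u) (b ∷ v) (c ∷ w) =
    trans (cong₂ _+F_ (*F-distribˡ-+F a b c) (dot-distribʳ-+V u v w))
      (+F-interchange (a *F b) (a *F c) (dot u v) (dot u w))

  dot-distribˡ-+V : ∀ {n} (u v w : Vect n) → dot (u +V v) w ≡ dot u w +F dot v w
  dot-distribˡ-+V []      []      []      = sym (+F-identityˡ 0F)
  dot-distribˡ-+V (a ∷ u) (b ∷ v) (c ∷ w) =
    trans (cong₂ _+F_ (*F-distribʳ-+F c a b) (dot-distribˡ-+V u v w))
      (+F-interchange (a *F c) (b *F c) (dot u w) (dot v w))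

  dot-•ˡ : ∀ {n} c (u v : Vect n) → dot (c • u) v ≡ c *F dot u v
  dot-•ˡ c []      []      = sym (*F-zeroʳ c)
  dot-•ˡ c (a ∷ u) (b ∷ v) =
    trans (cong₂ _+F_ (*F-assoc c a b) (dot-•ˡ c u v)) (sym (*F-distribˡ-+F c _ _))

  dot-unitRow : ∀ {n} (i : Fin n) (v : Vect n) → dot (unitRow i) v ≡ lookup v i
  dot-unitRow Fin.zero    (a ∷ v) = trans (cong₂ _+F_ (*F-identityˡ a) (dot-zeroˡ v)) (+F-identityʳ a)
  dot-unitRow (Fin.suc i) (a ∷ v) =
    trans (cong₂ _+F_ (*F-zeroˡ a) (trans (cong (λ u → dot u v) unitRow-suc) (dot-unitRow i v))) (+F-identityˡ _)
    where
    unitRow-suc : tabulate (λ j → if ⌊ Fin.suc i ≟F Fin.suc j ⌋ then 1F else 0F) ≡ unitRow i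
    unitRow-suc = tabulate-cong λ j → cong (λ b → if b then 1F else 0F) (suc≟suc j)
      where
      suc≟suc : ∀ j → ⌊ Fin.suc i ≟F Fin.suc j ⌋ ≡ ⌊ i ≟F j ⌋
      suc≟suc j with i ≟F j
      ... | yes _ = refl
      ... | no _  = refl

  ·-distrib-+V : ∀ {n} (M : Mat n) (u v : Vect n) → M · (u +V v) ≡ M · u +V M · v
  ·-distrib-+V {n} M u v = rows M
    where
    rows : ∀ {r} (R : Vec (Vect n) r) →
      map (λ row → dot row (u +V v)) R ≡ map (λ row → dot row u) R +V map (λ row → dot row v) R
    rows []        = refl
    rows (row ∷ R) = cong₂ _∷_ (dot-distribʳ-+V row u v) (rows R)

  ·-zeroV : ∀ {n} (M : Mat n) → M · zeroV ≡ zeroV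
  ·-zeroV {n} M = rows M
    where
    rows : ∀ {r} (R : Vec (Vect n) r) → map (λ row → dot row zeroV) R ≡ zeroV
    rows []        = refl
    rows (row ∷ R) = cong₂ _∷_ (dot-zeroʳ row) (rows R)

  -- Stated for non-square N, so that the induction on the rows of N goes through.
  dot-columns : ∀ {k n} (r : Vect k) (N : Vec (Vect n) k) (x : Vect n) →
    dot (tabulate (λ j → dot r (map (λ row → lookup row j) N))) x ≡ dot r (map (λ row → dot row x) N)
  dot-columns []      []        x = dot-zeroˡ x
  dot-columns (c ∷ r) (row ∷ N) x = begin
    dot (tabulate (λ j → (c *F lookup row j) +F colsN j)) x    ≡⟨ cong (λ u → dot u x) split ⟩
    dot (c • row +V tabulate colsN) x                         ≡⟨ dot-distribˡ-+V (c • row) (tabulate colsN) x ⟩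
    dot (c • row) x +F dot (tabulate colsN) x                 ≡⟨ cong₂ _+F_ (dot-•ˡ c row x) (dot-columns r N x) ⟩
    (c *F dot row x) +F dot r (map (λ row → dot row x) N)     ∎
    where
    open ≡-Reasoning
    colsN = λ j → dot r (map (λ row → lookup row j) N)
    split : tabulate (λ j → (c *F lookup row j) +F colsN j) ≡ c • row +V tabulate colsN
    split = trans (tabulate-zipWith (λ j → c *F lookup row j) colsN)
      (cong (_+V tabulate colsN) (trans (tabulate-∘ (c *F_) (lookup row)) (cong (c •_) (tabulate∘lookup row))))
      where
      tabulate-zipWith : ∀ {n} (f g : Fin n → F) → tabulate (λ j → f j +F g j) ≡ tabulate f +V tabulate g
      tabulate-zipWith {zero}  f g = refl
      tabulate-zipWith {suc n} f g = cong ((f Fin.zero +F g Fin.zero) ∷_) (tabulate-zipWith (f ∘ Fin.suc) (g ∘ Fin.suc))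

  ⊗-· : ∀ {n} (M N : Mat n) (x : Vect n) → (M ⊗ N) · x ≡ M · (N · x)
  ⊗-· {n} M N x = rows M
    where
    rows : ∀ {r} (R : Vec (Vect n) r) →
      map (λ row → dot row x) (map (λ row → tabulate (λ j → dot row (column N j))) R) ≡
      map (λ row → dot row (N · x)) R
    rows []        = refl
    rows (row ∷ R) = cong₂ _∷_ (dot-columns row N x) (rows R)

  idM-· : ∀ {n} (x : Vect n) → idM · x ≡ x
  idM-· x = trans (sym (tabulate-∘ (λ row → dot row x) unitRow))
    (trans (tabulate-cong (λ i → dot-unitRow i x)) (tabulate∘lookup x))

  ·-cancel : ∀ {n} {g h : Mat n} → g ⊗ h ≡ idM → ∀ x → g · (h · x) ≡ x
  ·-cancel {g = g} {h} gh≡id x = trans (sym (⊗-· g h x)) (trans (cong (_· x) gh≡id) (idM-· x))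

  open Counting.Enumeration (allFin p)

  nonzeroVectors : ∀ n → List (Vect n)
  nonzeroVectors n = filter (λ v → ¬? (v ≟V zeroV)) (vectors n)

  ∈-nonzeroVectors⁺ : ∀ {n} {v : Vect n} → ¬ v ≡ zeroV → v ∈ nonzeroVectors n
  ∈-nonzeroVectors⁺ v≢0 = ∈-filter⁺ (λ v → ¬? (v ≟V zeroV)) (∈-vectors ∈-allFin _) v≢0

  ∈-nonzeroVectors⁻ : ∀ {n} {v : Vect n} → v ∈ nonzeroVectors n → ¬ v ≡ zeroV
  ∈-nonzeroVectors⁻ {n} v∈ = proj₂ (∈-filter⁻ (λ v → ¬? (v ≟V zeroV)) {xs = vectors n} v∈)

  nonzeroVectors⁺ : ∀ n → Unique (nonzeroVectors n)
  nonzeroVectors⁺ n = filter⁺ (λ v → ¬? (v ≟V zeroV)) (vectors⁺ (allFin⁺ p) n)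

  length-nonzeroVectors : ∀ n → length (nonzeroVectors n) ≡ p ^ n ∸ 1
  length-nonzeroVectors n = cong (_∸ 1) (begin
    length (zeroV ∷ nonzeroVectors n)  ≡⟨ Counting.length-≡-⊆⊇ _≟V_
                                            (0∉ ∷ nonzeroVectors⁺ n) (vectors⁺ (allFin⁺ p) n) 0∷P⊆V V⊆0∷P ⟩
    length (vectors n)                 ≡⟨ length-vectors n ⟩
    length (allFin p) ^ n              ≡⟨ cong (_^ n) (length-tabulate (λ i → i)) ⟩
    p ^ n                              ∎)
    where
    open ≡-Reasoning
    0∉ : All (zeroV ≢_) (nonzeroVectors n)
    0∉ = All.tabulate λ v∈ 0≡v → ∈-nonzeroVectors⁻ v∈ (sym 0≡v)
    0∷P⊆V : zeroV ∷ nonzeroVectors n ⊆ vectors n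
    0∷P⊆V (here refl) = ∈-vectors ∈-allFin zeroV
    0∷P⊆V (there v∈)  = proj₁ (∈-filter⁻ (λ v → ¬? (v ≟V zeroV)) {xs = vectors n} v∈)
    V⊆0∷P : vectors n ⊆ zeroV ∷ nonzeroVectors n
    V⊆0∷P {v} _ with v ≟V zeroV
    ... | yes refl = here refl
    ... | no v≢0   = there (∈-nonzeroVectors⁺ v≢0)

module Orbits (p : ℕ) .{{_ : NonZero p}} {n} {H : List (GF.Mat p n)} (H-subgroup : GF.IsSubgroupGL p H) where
  open GF p
  open GFProperties p
  open IsSubgroupGL H-subgroup

  ·-injective : ∀ {h} → h ∈ H → ∀ {x y} → h · x ≡ h · y → x ≡ y
  ·-injective h∈H {x} {y} hx≡hy with closedInv h∈H
  ... | g , _ , gh≡id , _ = trans (sym (·-cancel gh≡id x)) (trans (cong (g ·_) hx≡hy) (·-cancel gh≡id y))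

  orbit⁺ : ∀ v → Unique (orbit H v)
  orbit⁺ v = deduplicate-! _≟V_ (L.map (λ h → h · v) H)

  ∈-orbit⁺ : ∀ {v h} → h ∈ H → h · v ∈ orbit H v
  ∈-orbit⁺ h∈H = ∈-deduplicate⁺ _≟V_ (∈-map⁺ _ h∈H)

  ∈-orbit⁻ : ∀ {v w} → w ∈ orbit H v → ∃[ h ] (h ∈ H × h · v ≡ w)
  ∈-orbit⁻ {v} w∈ with ∈-map⁻ (λ h → h · v) (∈-deduplicate⁻ _≟V_ (L.map (λ h → h · v) H) w∈)
  ... | h , h∈H , refl = h , h∈H , refl

  orbit-closed : ∀ {v w k} → k ∈ H → w ∈ orbit H v → k · w ∈ orbit H v
  orbit-closed {v} {k = k} k∈H w∈ with ∈-orbit⁻ w∈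
  ... | h , h∈H , refl = subst (_∈ orbit H v) (⊗-· k h v) (∈-orbit⁺ (closed⊗ k∈H h∈H))

  module _ {v₀ : Vect n} {S : Vect n → Set} (S-orbit : IsOrbitOf H v₀ S) where

    orbit-transitive : ∀ {s s'} → S s → S s' → ∃[ k ] (k ∈ H × k · s ≡ s')
    orbit-transitive {s} {s'} Ss Ss' with proj₁ (S-orbit s) Ss | proj₁ (S-orbit s') Ss'
    ... | h , h∈H , refl | h' , h'∈H , refl with closedInv h∈H
    ...   | g , g∈H , gh≡id , _ =
      h' ⊗ g , closed⊗ h'∈H g∈H , trans (⊗-· h' g (h · v₀)) (cong (h' ·_) (·-cancel gh≡id v₀))

    orbit-⊆ : ∀ {v w} → S v → w ∈ orbit H v → S w
    orbit-⊆ Sv w∈ with proj₁ (S-orbit _) Sv | ∈-orbit⁻ w∈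
    ... | g , g∈H , refl | h , h∈H , refl = subst S (⊗-· h g v₀) (proj₂ (S-orbit v₀) (closed⊗ h∈H g∈H))

    orbit-⊇ : ∀ {v w} → S v → S w → w ∈ orbit H v
    orbit-⊇ Sv Sw with orbit-transitive Sv Sw
    ... | k , k∈H , refl = ∈-orbit⁺ k∈H

module Decomposition (p : ℕ) .{{_ : NonZero p}} (m : ℕ)
  (B : GF.Mat p (m + m)) (B-invertible : GF.Invertible p B) where
  open GF p
  open GFProperties p

  ι₁ ι₂ : Vect m → Vect (m + m)
  ι₁ a = B · (a ++ zeroV)
  ι₂ b = B · (zeroV ++ b)

  π₁ π₂ : Vect (m + m) → Vect m
  π₁ w = take m (proj₁ B-invertible · w)
  π₂ w = drop m (proj₁ B-invertible · w)

  B-π : ∀ w → B · (π₁ w ++ π₂ w) ≡ w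
  B-π w = trans (cong (B ·_) (take++drop≡id m _)) (·-cancel (proj₁ (proj₂ B-invertible)) w)

  π-B : ∀ a b → π₁ (B · (a ++ b)) ≡ a × π₂ (B · (a ++ b)) ≡ b
  π-B a b = ++-injectiveˡ _ a π++π≡a++b , ++-injectiveʳ _ a π++π≡a++b
    where
    π++π≡a++b = trans (take++drop≡id m _) (·-cancel (proj₂ (proj₂ B-invertible)) (a ++ b))

  B-++ : ∀ a b → B · (a ++ b) ≡ ι₁ a +V ι₂ b
  B-++ a b = trans (cong (B ·_) (sym split)) (·-distrib-+V B (a ++ zeroV) (zeroV ++ b))
    where
    split : (a ++ zeroV) +V (zeroV ++ b) ≡ a ++ b
    split = trans (zipWith-++ _+F_ a zeroV zeroV b)
      (cong₂ _++_ (zipWith-identityʳ +F-identityʳ a) (zipWith-identityˡ +F-identityˡ b))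

  ι₁-zeroV : ι₁ zeroV ≡ zeroV
  ι₁-zeroV = trans (cong (B ·_) (zeroV-++ m)) (·-zeroV B)
    where
    zeroV-++ : ∀ k {l} → zeroV {k} ++ zeroV {l} ≡ zeroV
    zeroV-++ zero    = refl
    zeroV-++ (suc k) = cong (0F ∷_) (zeroV-++ k)

  ι₂-zeroV : ι₂ zeroV ≡ zeroV
  ι₂-zeroV = ι₁-zeroV

  ι₁-injective : ∀ {a a'} → ι₁ a ≡ ι₁ a' → a ≡ a'
  ι₁-injective {a} {a'} e = trans (sym (proj₁ (π-B a zeroV))) (trans (cong π₁ e) (proj₁ (π-B a' zeroV)))

  ι₂-injective : ∀ {b b'} → ι₂ b ≡ ι₂ b' → b ≡ b'
  ι₂-injective {b} {b'} e = trans (sym (proj₂ (π-B zeroV b))) (trans (cong π₂ e) (proj₂ (π-B zeroV b')))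

  InV₁⇒π₂≡0 : ∀ {w} → InV₁ m B w → π₂ w ≡ zeroV
  InV₁⇒π₂≡0 (a , refl) = proj₂ (π-B a zeroV)

  InV₂⇒π₁≡0 : ∀ {w} → InV₂ m B w → π₁ w ≡ zeroV
  InV₂⇒π₁≡0 (b , refl) = proj₁ (π-B zeroV b)

  π₂≡0⇒InV₁ : ∀ {w} → π₂ w ≡ zeroV → InV₁ m B w
  π₂≡0⇒InV₁ {w} π₂w≡0 = π₁ w , trans (sym (B-π w)) (cong (λ b → B · (π₁ w ++ b)) π₂w≡0)

  π₁≡0⇒InV₂ : ∀ {w} → π₁ w ≡ zeroV → InV₂ m B w
  π₁≡0⇒InV₂ {w} π₁w≡0 = π₂ w , trans (sym (B-π w)) (cong (λ a → B · (a ++ π₂ w)) π₁w≡0)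

  V₁∪V₂∖0 : Vect (m + m) → Set
  V₁∪V₂∖0 w = ¬ (w ≡ zeroV) × (InV₁ m B w ⊎ InV₂ m B w)

  ι₁∈V₁∪V₂∖0 : ∀ {a} → ¬ a ≡ zeroV → V₁∪V₂∖0 (ι₁ a)
  ι₁∈V₁∪V₂∖0 a≢0 = (λ ι₁a≡0 → a≢0 (ι₁-injective (trans ι₁a≡0 (sym ι₁-zeroV)))) , inj₁ (_ , refl)

  ι₂∈V₁∪V₂∖0 : ∀ {b} → ¬ b ≡ zeroV → V₁∪V₂∖0 (ι₂ b)
  ι₂∈V₁∪V₂∖0 b≢0 = (λ ι₂b≡0 → b≢0 (ι₂-injective (trans ι₂b≡0 (sym ι₂-zeroV)))) , inj₂ (_ , refl)

  axes : List (Vect (m + m))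
  axes = L.map ι₁ (nonzeroVectors m) L.++ L.map ι₂ (nonzeroVectors m)

  axes⁺ : Unique axes
  axes⁺ = ++⁺ (map⁺ ι₁-injective (nonzeroVectors⁺ m)) (map⁺ ι₂-injective (nonzeroVectors⁺ m)) disjoint
    where
    disjoint : Disjoint (L.map ι₁ (nonzeroVectors m)) (L.map ι₂ (nonzeroVectors m))
    disjoint (w∈ι₁P , w∈ι₂P) with ∈-map⁻ ι₁ w∈ι₁P | ∈-map⁻ ι₂ w∈ι₂P
    ... | a , a∈P , refl | b , _ , ι₁a≡ι₂b =
      ∈-nonzeroVectors⁻ a∈P (trans (sym (proj₁ (π-B a zeroV))) (trans (cong π₁ ι₁a≡ι₂b) (proj₁ (π-B zeroV b))))

  length-axes : length axes ≡ length (nonzeroVectors m) + length (nonzeroVectors m)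
  length-axes = trans (length-++ (L.map ι₁ (nonzeroVectors m)))
    (cong₂ _+_ (length-map ι₁ (nonzeroVectors m)) (length-map ι₂ (nonzeroVectors m)))

  ∈-axes⁺ : ∀ {w} → V₁∪V₂∖0 w → w ∈ axes
  ∈-axes⁺ (w≢0 , inj₁ (a , refl)) =
    ∈-++⁺ˡ (∈-map⁺ ι₁ (∈-nonzeroVectors⁺ λ a≡0 → w≢0 (trans (cong ι₁ a≡0) ι₁-zeroV)))
  ∈-axes⁺ (w≢0 , inj₂ (b , refl)) =
    ∈-++⁺ʳ (L.map ι₁ (nonzeroVectors m)) (∈-map⁺ ι₂ (∈-nonzeroVectors⁺ λ b≡0 → w≢0 (trans (cong ι₂ b≡0) ι₂-zeroV)))

  ∈-axes⁻ : ∀ {w} → w ∈ axes → V₁∪V₂∖0 w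
  ∈-axes⁻ w∈ with ∈-++⁻ (L.map ι₁ (nonzeroVectors m)) w∈
  ... | inj₁ w∈ι₁P with ∈-map⁻ ι₁ w∈ι₁P
  ...   | a , a∈P , refl = ι₁∈V₁∪V₂∖0 (∈-nonzeroVectors⁻ a∈P)
  ∈-axes⁻ w∈ | inj₂ w∈ι₂P with ∈-map⁻ ι₂ w∈ι₂P
  ...   | b , b∈P , refl = ι₂∈V₁∪V₂∖0 (∈-nonzeroVectors⁻ b∈P)

module PairStabiliser (p : ℕ) .{{_ : NonZero p}} (m : ℕ)
  (B : GF.Mat p (m + m)) (B-invertible : GF.Invertible p B)
  {H : List (GF.Mat p (m + m))} (H-subgroup : GF.IsSubgroupGL p H)
  (H-stabilises : GF.StabilisesPair p H (GF.InV₁ p m B) (GF.InV₂ p m B))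
  {v₀ : GF.Vect p (m + m)} (V₁∪V₂∖0-orbit : GF.IsOrbitOf p H v₀ (Decomposition.V₁∪V₂∖0 p m B B-invertible)) where
  open GF p
  open GFProperties p
  open Orbits p H-subgroup
  open IsSubgroupGL H-subgroup
  open Decomposition p m B B-invertible
  open Counting.Fibres _≟V_ π₁

  V₁-transitive : ∀ {a a'} → ¬ a ≡ zeroV → ¬ a' ≡ zeroV →
    ∃[ k ] (k ∈ H × k · ι₁ a ≡ ι₁ a' × (∀ w → InV₂ m B w → InV₂ m B (k · w)))
  V₁-transitive {a} a≢0 a'≢0 with orbit-transitive V₁∪V₂∖0-orbit (ι₁∈V₁∪V₂∖0 a≢0) (ι₁∈V₁∪V₂∖0 a'≢0)
  ... | k , k∈H , ka≡a' with H-stabilises k∈H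
  ...   | inj₁ (_ , V₂↠V₂) = k , k∈H , ka≡a' , proj₁ V₂↠V₂
  ...   | inj₂ (V₁↠V₂ , _) = ⊥-elim (a'≢0 (trans (sym (proj₁ (π-B _ zeroV)))
          (InV₂⇒π₁≡0 (subst (InV₂ m B) ka≡a' (proj₁ V₁↠V₂ _ (a , refl))))))

  π₁-translate : ∀ {k a a'} → k · ι₁ a ≡ ι₁ a' → (∀ w → InV₂ m B w → InV₂ m B (k · w)) →
    ∀ w → π₁ w ≡ a → π₁ (k · w) ≡ a'
  π₁-translate {k} {a' = a'} ka≡a' kV₂⊆V₂ w refl with kV₂⊆V₂ (ι₂ (π₂ w)) (π₂ w , refl)
  ... | b' , kι₂≡ι₂b' = trans (cong π₁ kw≡) (proj₁ (π-B a' b'))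
    where
    open ≡-Reasoning
    kw≡ : k · w ≡ B · (a' ++ b')
    kw≡ = begin
      k · w                                ≡⟨ cong (k ·_) (trans (sym (B-π w)) (B-++ (π₁ w) (π₂ w))) ⟩
      k · (ι₁ (π₁ w) +V ι₂ (π₂ w))         ≡⟨ ·-distrib-+V k _ _ ⟩
      k · ι₁ (π₁ w) +V k · ι₂ (π₂ w)       ≡⟨ cong₂ _+V_ ka≡a' kι₂≡ι₂b' ⟩
      ι₁ a' +V ι₂ b'                       ≡⟨ B-++ a' b' ⟨
      B · (a' ++ b')                       ∎

  length-fibre-≤ : ∀ v {y y'} → y ∈ nonzeroVectors m → y' ∈ nonzeroVectors m →
    length (fibre y (orbit H v)) ≤ length (fibre y' (orbit H v))
  length-fibre-≤ v {y} {y'} y∈P y'∈P with V₁-transitive (∈-nonzeroVectors⁻ y∈P) (∈-nonzeroVectors⁻ y'∈P)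
  ... | k , k∈H , ky≡y' , kV₂⊆V₂ = begin
    length (fibre y (orbit H v))                ≡⟨ length-map (k ·_) (fibre y (orbit H v)) ⟨
    length (L.map (k ·_) (fibre y (orbit H v))) ≤⟨ Counting.length-mono-⊆ _≟V_ k·fibre⁺ k·fibre⊆fibre ⟩
    length (fibre y' (orbit H v))               ∎
    where
    open ≤-Reasoning
    k·fibre⁺ = map⁺ (·-injective k∈H) (filter⁺ (λ x → π₁ x ≟V y) (orbit⁺ v))
    k·fibre⊆fibre : L.map (k ·_) (fibre y (orbit H v)) ⊆ fibre y' (orbit H v)
    k·fibre⊆fibre kw∈ with ∈-map⁻ (k ·_) kw∈
    ... | w , w∈fibre , refl with ∈-filter⁻ (λ x → π₁ x ≟V y) {xs = orbit H v} w∈fibre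
    ...   | w∈orbit , π₁w≡y =
      ∈-filter⁺ (λ x → π₁ x ≟V y') (orbit-closed k∈H w∈orbit) (π₁-translate ky≡y' kV₂⊆V₂ w π₁w≡y)

  off-axes-orbit-length : ∀ v → ¬ π₁ v ≡ zeroV → ¬ π₂ v ≡ zeroV → length (nonzeroVectors m) ∣ length (orbit H v)
  off-axes-orbit-length v π₁v≢0 π₂v≢0 = equal-fibres⇒∣ (nonzeroVectors⁺ m) (orbit H v)
    (λ w∈ → ∈-nonzeroVectors⁺ (π₁-orbit≢0 w∈))
    (λ y∈P → ≤-antisym (length-fibre-≤ v y∈P π₁v∈P) (length-fibre-≤ v π₁v∈P y∈P))
    where
    π₁v∈P = ∈-nonzeroVectors⁺ π₁v≢0
    π₁-orbit≢0 : ∀ {w} → w ∈ orbit H v → ¬ π₁ w ≡ zeroV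
    π₁-orbit≢0 w∈ π₁w≡0 with ∈-orbit⁻ w∈
    ... | h , h∈H , refl with closedInv h∈H
    ...   | g , g∈H , gh≡id , _ with H-stabilises g∈H
    ...     | inj₁ (_ , V₂↠V₂) =
      π₁v≢0 (InV₂⇒π₁≡0 (subst (InV₂ m B) (·-cancel gh≡id v) (proj₁ V₂↠V₂ _ (π₁≡0⇒InV₂ π₁w≡0))))
    ...     | inj₂ (_ , V₂↠V₁) =
      π₂v≢0 (InV₁⇒π₂≡0 (subst (InV₁ m B) (·-cancel gh≡id v) (proj₁ V₂↠V₁ _ (π₁≡0⇒InV₂ π₁w≡0))))

  on-axes-orbit-length : ∀ {v} → V₁∪V₂∖0 v → length (orbit H v) ≡ length (nonzeroVectors m) + length (nonzeroVectors m)
  on-axes-orbit-length v∈ = trans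
    (Counting.length-≡-⊆⊇ _≟V_ (orbit⁺ _) axes⁺
      (∈-axes⁺ ∘ orbit-⊆ V₁∪V₂∖0-orbit v∈) (orbit-⊇ V₁∪V₂∖0-orbit v∈ ∘ ∈-axes⁻))
    length-axes

lemma6p2 : (p : ℕ) .{{_ : NonZero p}} → Prime p → (m : ℕ) →
    let open GF p in
    (B : Mat (m + m)) → Invertible B →
    (H : List (Mat (m + m))) → IsSubgroupGL H →
    StabilisesPair H (InV₁ m B) (InV₂ m B) →
    (∃[ v₀ ] IsOrbitOf H v₀ (λ w → ¬ (w ≡ zeroV) × (InV₁ m B w ⊎ InV₂ m B w))) →
    (v : Vect (m + m)) → ¬ (v ≡ zeroV) → (p ^ m ∸ 1) ∣ orbitLength H v
lemma6p2 p _ m B B-invertible H H-subgroup H-stabilises (_ , V₁∪V₂∖0-orbit) v v≢0 =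
  subst (_∣ orbitLength H v) (length-nonzeroVectors m) (by-cases (π₁ v ≟V zeroV) (π₂ v ≟V zeroV))
  where
  open GF p
  open GFProperties p
  open Decomposition p m B B-invertible
  open PairStabiliser p m B B-invertible H-subgroup H-stabilises V₁∪V₂∖0-orbit

  on-axes : V₁∪V₂∖0 v → length (nonzeroVectors m) ∣ orbitLength H v
  on-axes v∈ = subst (length (nonzeroVectors m) ∣_) (sym (on-axes-orbit-length v∈)) (∣m∣n⇒∣m+n ∣-refl ∣-refl)

  by-cases : Dec (π₁ v ≡ zeroV) → Dec (π₂ v ≡ zeroV) → length (nonzeroVectors m) ∣ orbitLength H v
  by-cases (yes π₁v≡0) _           = on-axes (v≢0 , inj₂ (π₁≡0⇒InV₂ π₁v≡0))
  by-cases (no _)      (yes π₂v≡0) = on-axes (v≢0 , inj₁ (π₂≡0⇒InV₁ π₂v≡0))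
  by-cases (no π₁v≢0)  (no π₂v≢0)  = off-axes-orbit-length v π₁v≢0 π₂v≢0
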